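{- Let $r\geq 1$, $p$ and $\ell$ be integers with $1\leq p<r$, and let $G$ be the complete $(\ell+1)$-partite graph having $\ell$ parts of size $r$ and one part of size $p$. Let $k\geq 2$ be an integer and $\ell_0=\left\lceil \max\left\{\sqrt{\tfrac{k}{2}+1},\ \tfrac{k-1}{r}+2\right\}\right\rceil$. If $\ell\geq \ell_0^2$, then $rc_k(G)=2$.
   Context: In an edge-colored graph (adjacent edges may receive the same color), a path is rainbow if no two of its edges have the same color. For a $\kappa$-connected graph $G$ and an integer $k$ with $1\leq k\leq\kappa$, the rainbow $k$-connectivity $rc_k(G)$ is the minimum integer $j$ such that there is an edge-coloring of $G$ with $j$ colors in which every two distinct vertices $u,v$ are connected by at least $k$ internally disjoint rainbow $u$–$v$ paths. -}

module Defs where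

open import Data.Nat using (ℕ; zero; suc; _+_; _*_; _∸_; _≤_; _<_)
open import Data.Fin using (Fin)
open import Data.Product using (_×_; _,_; Σ; Σ-syntax)
open import Data.Sum using (_⊎_; inj₁; inj₂)
open import Data.List using (List; []; _∷_; _++_; [_]; map)
open import Data.List.Relation.Unary.Linked using (Linked)
open import Data.List.Relation.Unary.Unique.Propositional using (Unique)
open import Data.List.Membership.Propositional using (_∈_; _∉_)
open import Relation.Binary.PropositionalEquality using (_≡_; _≢_)
open import Relation.Nullary using (¬_)

-- A graph on vertex type V is given by a (symmetric, irreflexive) adjacency
-- relation Adj.  An edge-colouring with j colours is a symmetric function
-- c : V → V → Fin j; only its values on edges {u,v} (Adj u v) matter.

Colouring : (V : Set) → ℕ → Set
Colouring V j = Σ[ c ∈ (V → V → Fin j) ] (∀ u v → c u v ≡ c v u)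

steps : {V : Set} → List V → List (V × V)
steps (x ∷ y ∷ xs) = (x , y) ∷ steps (y ∷ xs)
steps _            = []

-- A u–v path, given by its list of internal vertices.
fullPath : {V : Set} → V → List V → V → List V
fullPath u int v = u ∷ (int ++ [ v ])

IsPath : {V : Set} (Adj : V → V → Set) → V → List V → V → Set
IsPath Adj u int v = Linked Adj (fullPath u int v) × Unique (fullPath u int v)

IsRainbow : {V : Set} {j : ℕ} → (V → V → Fin j) → V → List V → V → Set
IsRainbow c u int v = Unique (map (λ e → c (Data.Product.proj₁ e) (Data.Product.proj₂ e)) (steps (fullPath u int v)))

KRainbowPaths : {V : Set} (Adj : V → V → Set) {j : ℕ} → (V → V → Fin j) →
                ℕ → V → V → Set
KRainbowPaths {V} Adj c k u v =
  Σ[ P ∈ (Fin k → List V) ]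
    ((∀ i → IsPath Adj u (P i) v × IsRainbow c u (P i) v) ×
     (∀ i i′ → i ≢ i′ → (P i ≢ P i′) × (∀ x → x ∈ P i → x ∉ P i′)))

RainbowKConnectedWith : {V : Set} (Adj : V → V → Set) → ℕ → ℕ → Set
RainbowKConnectedWith {V} Adj k j =
  Σ[ col ∈ Colouring V j ]
    (∀ u v → u ≢ v → KRainbowPaths Adj (Data.Product.proj₁ col) k u v)

RcEquals : {V : Set} (Adj : V → V → Set) → ℕ → ℕ → Set
RcEquals Adj k j =
  RainbowKConnectedWith Adj k j × (∀ j′ → j′ < j → ¬ RainbowKConnectedWith Adj k j′)

MPVertex : ℕ → ℕ → ℕ → Set
MPVertex ℓ r p = (Fin ℓ × Fin r) ⊎ Fin p

part : {ℓ r p : ℕ} → MPVertex ℓ r p → Fin (suc ℓ)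
part (inj₁ (i , _)) = Fin.suc i
part (inj₂ _)       = Fin.zero

MPAdj : (ℓ r p : ℕ) → MPVertex ℓ r p → MPVertex ℓ r p → Set
MPAdj ℓ r p x y = part x ≢ part y

-- ℓ₀ = ⌈ max { √(k/2 + 1) , (k-1)/r + 2 } ⌉, for r ≥ 1.
-- For a natural m:  m ≥ √(k/2+1)  ⇔  2m² ≥ k + 2,
--                   m ≥ (k-1)/r + 2  ⇔  r·m ≥ (k-1) + 2r   (r ≥ 1, k ≥ 1).
-- ℓ₀ is the least natural number m satisfying both (both bounds are > 0).

AboveBounds : ℕ → ℕ → ℕ → Set
AboveBounds k r m = (k + 2 ≤ 2 * (m * m)) × ((k ∸ 1) + 2 * r ≤ r * m)

IsEll0 : ℕ → ℕ → ℕ → Set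
IsEll0 k r m = AboveBounds k r m × (∀ m′ → AboveBounds k r m′ → m ≤ m′)

-- Label the vertices of each part 0, 1, … and colour the edge uw by τ(a, b) xor [u and w have
-- the same label], where a, b are the parts of u and w and τ is a 2-colouring of pairs of parts.
-- A vertex w outside the parts of u and v is then the middle of a rainbow path u w v whenever
-- either τ(a, ·) and τ(b, ·) differ at the part of w and the label of w equals both or neither
-- of those of u and v, or τ(a, ·) and τ(b, ·) agree there and it equals exactly one of them.
-- Place the ℓ + 1 parts in a grid with rows of length ℓ₀ and let τ(a, b) say that a and b share
-- exactly one of row and column; as ℓ₀² ≤ ℓ, every two parts are separated by ℓ₀ − 2 parts and
-- agreed on by ℓ₀ − 2 others. This yields 2(ℓ − 1) rainbow paths between two vertices of one part
-- and, with the edge uv, 1 + (ℓ₀ − 2)r between vertices of different parts; the two bounds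
-- defining ℓ₀ make both at least k. One colour is not enough, since two vertices of the same part
-- are not adjacent.

module Submission where

open import Defs
open import Data.Bool using (Bool; true; false; _xor_)
open import Data.Bool.Properties using (xor-assoc; xor-comm; xor-same; xor-identityʳ)
open import Data.Empty using (⊥; ⊥-elim)
open import Data.Fin as Fin using (Fin; zero; suc; toℕ; fromℕ<; inject≤; punchIn; remQuot; splitAt)
import Data.Fin.Properties as Finₚ
open import Data.List using (List; []; _∷_)
open import Data.List.Properties using (∷-injectiveˡ)
open import Data.List.Relation.Unary.AllPairs using ([]; _∷_)
open import Data.List.Relation.Unary.All using ([]; _∷_)
open import Data.List.Relation.Unary.Any using (here; there)
open import Data.List.Relation.Unary.Linked using ([]; [-]; _∷_)
open import Data.List.Membership.Propositional using (_∈_; _∉_)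
open import Data.Nat using (ℕ; suc; _+_; _*_; _∸_; _≤_; _<_; z≤n; s≤s; _≟_)
open import Data.Nat.Properties
open import Data.Nat.DivMod
open import Data.Nat.Divisibility using (divides-refl)
open import Data.Product as Product using (_×_; _,_; proj₁; proj₂; swap)
open import Data.Sum using (_⊎_; inj₁; inj₂; [_,_]′)
open import Data.Sum.Properties using (inj₁-injective)
open import Data.Unit using (⊤; tt)
open import Function using (_∘_; id)
open import Function.Bundles using (Injection; Inverse; mk⇔)
open import Function.Definitions using (Injective)
open import Function.Properties.Inverse using (↔⇒↣; ↔-sym)
open import Relation.Binary.Definitions using (DecidableEquality; tri<; tri≈; tri>)
open import Relation.Binary.PropositionalEquality
open import Relation.Nullary using (¬_; yes; no; does)
open import Relation.Nullary.Decidable using (dec-true; dec-false; does-⇔)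

private
  variable
    A B : Set
    P Q : A → Set
    k m n : ℕ

record Family (A : Set) (P : A → Set) (n : ℕ) : Set where
  field
    member    : Fin n → A
    injective : Injective _≡_ _≡_ member
    valid     : ∀ i → P (member i)

open Family

image : (f : A → B) → Injective _≡_ _≡_ f → (∀ {a} → P a → Q (f a)) →
        Family A P n → Family B Q n
image f f-injective f-valid F = record
  { member    = f ∘ member F
  ; injective = λ eq → injective F (f-injective eq)
  ; valid     = λ i → f-valid (valid F i)
  }

weaken : (∀ {a} → P a → Q a) → Family A P n → Family A Q n
weaken = image id id

everything : ∀ n → Family (Fin n) (λ _ → ⊤) n
everything n = record { member = id ; injective = id ; valid = λ _ → tt }

pair : {x y : A} → x ≢ y → Family A (λ a → a ≡ x ⊎ a ≡ y) 2
pair {A} {x} {y} x≢y = record { member = member′ ; injective = injective′ ; valid = valid′ }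
  where
    member′ : Fin 2 → A
    member′ zero       = x
    member′ (suc zero) = y
    injective′ : Injective _≡_ _≡_ member′
    injective′ {zero}     {zero}     _  = refl
    injective′ {zero}     {suc zero} eq = ⊥-elim (x≢y eq)
    injective′ {suc zero} {zero}     eq = ⊥-elim (x≢y (sym eq))
    injective′ {suc zero} {suc zero} _  = refl
    valid′ : ∀ i → member′ i ≡ x ⊎ member′ i ≡ y
    valid′ zero       = inj₁ refl
    valid′ (suc zero) = inj₂ refl

product : Family A P m → Family B Q n →
          Family (A × B) (λ ab → P (proj₁ ab) × Q (proj₂ ab)) (m * n)
product {m = m} {n = n} F G = record
  { member    = Product.map (member F) (member G) ∘ remQuot n
  ; injective = λ eq → remQuot-injective
      (cong₂ _,_ (injective F (cong proj₁ eq)) (injective G (cong proj₂ eq)))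
  ; valid     = λ i → valid F _ , valid G _
  }
  where remQuot-injective = Injection.injective (↔⇒↣ (Finₚ.*↔× {m} {n}))

union : (∀ {a} → P a → Q a → ⊥) → Family A P m → Family A Q n →
        Family A (λ a → P a ⊎ Q a) (m + n)
union {P = P} {Q = Q} {m = m} {n = n} disjoint F G = record
  { member    = join ∘ splitAt m
  ; injective = λ eq → splitAt-injective (join-injective _ _ eq)
  ; valid     = join-valid ∘ splitAt m
  }
  where
    splitAt-injective = Injection.injective (↔⇒↣ (Finₚ.+↔⊎ {m} {n}))
    join : Fin m ⊎ Fin n → _
    join = [ member F , member G ]′
    join-injective : ∀ s t → join s ≡ join t → s ≡ t
    join-injective (inj₁ i) (inj₁ j) eq = cong inj₁ (injective F eq)
    join-injective (inj₂ i) (inj₂ j) eq = cong inj₂ (injective G eq)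
    join-injective (inj₁ i) (inj₂ j) eq =
      ⊥-elim (disjoint (valid F i) (subst Q (sym eq) (valid G j)))
    join-injective (inj₂ i) (inj₁ j) eq =
      ⊥-elim (disjoint (valid F j) (subst Q eq (valid G i)))
    join-valid : ∀ s → P (join s) ⊎ Q (join s)
    join-valid (inj₁ i) = inj₁ (valid F i)
    join-valid (inj₂ i) = inj₂ (valid G i)

without : ∀ α → Family (Fin n) P (suc k) → Family (Fin n) (λ x → P x × toℕ x ≢ α) k
without α F with Finₚ.any? (λ z → toℕ (member F z) ≟ α)
... | yes (z₀ , hit) = record
  { member    = member F ∘ punchIn z₀
  ; injective = λ eq → Finₚ.punchIn-injective z₀ _ _ (injective F eq)
  ; valid     = λ z → valid F (punchIn z₀ z) , λ hit′ →
      Finₚ.punchInᵢ≢i z₀ z (injective F (Finₚ.toℕ-injective (trans hit′ (sym hit))))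
  }
... | no miss = record
  { member    = member F ∘ suc
  ; injective = λ eq → Finₚ.suc-injective (injective F eq)
  ; valid     = λ z → valid F (suc z) , λ hit → miss (suc z , hit)
  }

avoiding : ∀ n α β → Family (Fin (2 + n)) (λ x → toℕ x ≢ α × toℕ x ≢ β) n
avoiding n α β =
  weaken (λ ((_ , ≢α) , ≢β) → ≢α , ≢β) (without β (without α (everything (2 + n))))

xor-cancelʳ : ∀ x y → (x xor y) xor y ≡ x
xor-cancelʳ x y = begin
  (x xor y) xor y  ≡⟨ xor-assoc x y y ⟩
  x xor (y xor y)  ≡⟨ cong (x xor_) (xor-same y) ⟩
  x xor false      ≡⟨ xor-identityʳ x ⟩
  x                ∎
  where open ≡-Reasoning

xor-≢ˡ : ∀ {x x′ y y′} → x ≢ x′ → y ≡ y′ → x xor y ≢ x′ xor y′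
xor-≢ˡ {x} {x′} {y} x≢x′ refl eq =
  x≢x′ (trans (sym (xor-cancelʳ x y)) (trans (cong (_xor y) eq) (xor-cancelʳ x′ y)))

xor-≢ʳ : ∀ {x x′ y y′} → x ≡ x′ → y ≢ y′ → x xor y ≢ x′ xor y′
xor-≢ʳ {x} {_} {y} {y′} refl y≢y′ eq =
  xor-≢ˡ y≢y′ refl (trans (xor-comm y x) (trans eq (xor-comm x y′)))

≡true-≡false⇒≢ : ∀ {x y} → x ≡ true → y ≡ false → x ≢ y
≡true-≡false⇒≢ refl refl ()

module _ {A : Set} (_≟ᴬ_ : DecidableEquality A) where

  does-sym : ∀ x y → does (x ≟ᴬ y) ≡ does (y ≟ᴬ x)
  does-sym x y = does-⇔ (mk⇔ sym sym) (x ≟ᴬ y) (y ≟ᴬ x)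

  does-≢-oneOf : ∀ {x y z} → x ≢ y → z ≡ x ⊎ z ≡ y → does (x ≟ᴬ z) ≢ does (y ≟ᴬ z)
  does-≢-oneOf {x} {y} {z} x≢y (inj₁ refl) =
    ≡true-≡false⇒≢ (dec-true (x ≟ᴬ z) refl) (dec-false (y ≟ᴬ z) (x≢y ∘ sym))
  does-≢-oneOf {x} {y} {z} x≢y (inj₂ refl) eq =
    ≡true-≡false⇒≢ (dec-true (y ≟ᴬ z) refl) (dec-false (x ≟ᴬ z) x≢y) (sym eq)

  does-≡-neither : ∀ {x y z} → z ≢ x → z ≢ y → does (x ≟ᴬ z) ≡ does (y ≟ᴬ z)
  does-≡-neither {x} {y} {z} z≢x z≢y =
    trans (dec-false (x ≟ᴬ z) (z≢x ∘ sym)) (sym (dec-false (y ≟ᴬ z) (z≢y ∘ sym)))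

m+2≤2n⇒m≤2[n∸1] : ∀ m n → m + 2 ≤ 2 * n → m ≤ 2 * (n ∸ 1)
m+2≤2n⇒m≤2[n∸1] m n m+2≤2n = begin
  m            ≤⟨ m+n≤o⇒m≤o∸n m m+2≤2n ⟩
  2 * n ∸ 2    ≡⟨ *-distribˡ-∸ 2 n 1 ⟨
  2 * (n ∸ 1)  ∎
  where open ≤-Reasoning

[k∸1]+2r≤rl⇒2<l : ∀ k r l → 2 ≤ k → (k ∸ 1) + 2 * r ≤ r * l → 2 < l
[k∸1]+2r≤rl⇒2<l k r l 2≤k le = *-cancelˡ-< r 2 l (begin-strict
  r * 2          ≡⟨ *-comm r 2 ⟩
  2 * r          <⟨ +-monoˡ-≤ (2 * r) (∸-monoˡ-≤ 1 2≤k) ⟩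
  (k ∸ 1) + 2 * r ≤⟨ le ⟩
  r * l          ∎)
  where open ≤-Reasoning

[k∸1]+2r≤rl⇒k≤1+[l∸2]r : ∀ k r l → (k ∸ 1) + 2 * r ≤ r * l → k ≤ suc ((l ∸ 2) * r)
[k∸1]+2r≤rl⇒k≤1+[l∸2]r k r l le = begin
  k                    ≤⟨ m≤n+m∸n k 1 ⟩
  suc (k ∸ 1)          ≤⟨ s≤s (m+n≤o⇒m≤o∸n (k ∸ 1) le) ⟩
  suc (r * l ∸ 2 * r)  ≡⟨ cong (λ x → suc (r * l ∸ x)) (*-comm 2 r) ⟩
  suc (r * l ∸ r * 2)  ≡⟨ cong suc (*-distribˡ-∸ r l 2) ⟨
  suc (r * (l ∸ 2))    ≡⟨ cong suc (*-comm r (l ∸ 2)) ⟩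
  suc ((l ∸ 2) * r)    ∎
  where open ≤-Reasoning

Fin1-≡ : ∀ {a b : Fin 1} → a ≡ b
Fin1-≡ = Injection.injective (↔⇒↣ Finₚ.1↔⊤) refl

module _ {V : Set} {Adj : V → V → Set} where

  noColouring₀ : V → ¬ RainbowKConnectedWith Adj k 0
  noColouring₀ x ((c , _) , _) with c x x
  ... | ()

  noColouring₁ : ∀ {u v} → u ≢ v → ¬ Adj u v → ¬ RainbowKConnectedWith Adj (suc k) 1
  noColouring₁ {u = u} {v} u≢v ¬uv ((c , _) , connected) with connected u v u≢v
  ... | P , paths , _ with P zero | paths zero
  ... | []        | ((uv ∷ _) , _) , _     = ¬uv uv
  ... | _ ∷ []    | _ , ((c≢ ∷ _) ∷ _)     = c≢ Fin1-≡
  ... | _ ∷ _ ∷ _ | _ , ((c≢ ∷ _) ∷ _)     = c≢ Fin1-≡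

  KRainbowPaths-≤ : ∀ {j} {c : V → V → Fin j} {u v} → k ≤ n →
                    KRainbowPaths Adj c n u v → KRainbowPaths Adj c k u v
  KRainbowPaths-≤ k≤n (P , paths , disjoint) =
    (λ i → P (inject≤ i k≤n)) , (λ i → paths (inject≤ i k≤n)) ,
    λ i i′ i≢i′ → disjoint (inject≤ i k≤n) (inject≤ i′ k≤n)
                    (i≢i′ ∘ Finₚ.inject≤-injective k≤n k≤n i i′)

module RainbowMiddles {V : Set} (Adj : V → V → Set) (irreflexive : ∀ {x} → ¬ Adj x x)
                      {j : ℕ} (c : V → V → Fin j) where

  RainbowMiddle : V → V → V → Set
  RainbowMiddle u v w = Adj u w × Adj w v × c u w ≢ c w v

  adjacent⇒≢ : ∀ {u v} → Adj u v → u ≢ v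
  adjacent⇒≢ uv refl = irreflexive uv

  middlePath : ∀ {u v w} → u ≢ v → RainbowMiddle u v w →
               IsPath Adj u (w ∷ []) v × IsRainbow c u (w ∷ []) v
  middlePath u≢v (uw , wv , c≢) =
    ((uw ∷ wv ∷ [-]) , ((adjacent⇒≢ uw ∷ u≢v ∷ []) ∷ (adjacent⇒≢ wv ∷ []) ∷ [] ∷ [])) ,
    ((c≢ ∷ []) ∷ [] ∷ [])

  singletons-disjoint : (f : Fin k → V) → Injective _≡_ _≡_ f → ∀ z z′ → z ≢ z′ →
    (f z ∷ [] ≢ f z′ ∷ []) × (∀ x → x ∈ f z ∷ [] → x ∉ f z′ ∷ [])
  singletons-disjoint f f-injective z z′ z≢z′ =
    (λ eq → z≢z′ (f-injective (∷-injectiveˡ eq))) ,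
    λ { _ (here refl) (here eq) → z≢z′ (f-injective eq) ; _ (here _) (there ()) ; _ (there ()) _ }

  middlePaths : ∀ {u v} → u ≢ v → Family V (RainbowMiddle u v) k → KRainbowPaths Adj c k u v
  middlePaths u≢v F =
    (λ z → member F z ∷ []) , (λ z → middlePath u≢v (valid F z)) ,
    singletons-disjoint (member F) (injective F)

  edgeAndMiddlePaths : ∀ {u v} → Adj u v → Family V (RainbowMiddle u v) k →
                       KRainbowPaths Adj c (suc k) u v
  edgeAndMiddlePaths {k = k} {u} {v} uv F = interior , paths , disjoint
    where
      interior : Fin (suc k) → List V
      interior zero    = []
      interior (suc z) = member F z ∷ []
      paths : ∀ i → IsPath Adj u (interior i) v × IsRainbow c u (interior i) v
      paths zero    = ((uv ∷ [-]) , ((adjacent⇒≢ uv ∷ []) ∷ [] ∷ [])) , ([] ∷ [])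
      paths (suc z) = middlePath (adjacent⇒≢ uv) (valid F z)
      disjoint : ∀ i i′ → i ≢ i′ →
                 (interior i ≢ interior i′) × (∀ x → x ∈ interior i → x ∉ interior i′)
      disjoint zero    zero     i≢i′ = ⊥-elim (i≢i′ refl)
      disjoint zero    (suc _)  _    = (λ ()) , λ _ ()
      disjoint (suc _) zero     _    = (λ ()) , λ _ _ ()
      disjoint (suc z) (suc z′) i≢i′ =
        singletons-disjoint (member F) (injective F) z z′ (i≢i′ ∘ cong suc)

Separates Agrees : (ℕ → ℕ → Bool) → ℕ → ℕ → ℕ → Set
Separates τ a b w = w ≢ a × w ≢ b × τ a w ≢ τ b w
Agrees    τ a b w = w ≢ a × w ≢ b × τ a w ≡ τ b w

Separates-sym : ∀ {τ a b w} → Separates τ a b w → Separates τ b a w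
Separates-sym (w≢a , w≢b , τ≢) = w≢b , w≢a , τ≢ ∘ sym

module TwoColouring {ℓ′ r″ p m : ℕ} (p≤r : p ≤ 2 + r″)
  (τ : ℕ → ℕ → Bool) (τ-sym : ∀ a b → τ a b ≡ τ b a)
  (separating : ∀ {a b} → a ≢ b → a ≤ suc ℓ′ → b ≤ suc ℓ′ →
                Family (Fin (suc ℓ′)) (λ i → Separates τ a b (toℕ i)) m)
  (agreeing : ∀ a b → Family (Fin (suc ℓ′)) (λ i → Agrees τ a b (toℕ i)) m)
  where

  ℓ r : ℕ
  ℓ = suc ℓ′
  r = 2 + r″

  V : Set
  V = MPVertex ℓ r p

  Adj : V → V → Set
  Adj = MPAdj ℓ r p

  rank : Fin (suc ℓ) → ℕ
  rank zero    = ℓ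
  rank (suc i) = toℕ i

  index : V → ℕ
  index u = rank (part u)

  index≤ℓ : ∀ u → index u ≤ ℓ
  index≤ℓ (inj₁ (i , _)) = <⇒≤ (Finₚ.toℕ<n i)
  index≤ℓ (inj₂ _)       = ≤-refl

  label : V → Fin r
  label (inj₁ (_ , d)) = d
  label (inj₂ d)       = inject≤ d p≤r

  ≡-byIndexLabel : ∀ {u v} → index u ≡ index v → label u ≡ label v → u ≡ v
  ≡-byIndexLabel {inj₁ (i , d)} {inj₁ (j , .d)} i≡j refl =
    cong (λ i → inj₁ (i , d)) (Finₚ.toℕ-injective i≡j)
  ≡-byIndexLabel {inj₁ (i , _)} {inj₂ _} i≡ℓ _ = ⊥-elim (<-irrefl i≡ℓ (Finₚ.toℕ<n i))
  ≡-byIndexLabel {inj₂ _} {inj₁ (j , _)} ℓ≡j _ = ⊥-elim (<-irrefl (sym ℓ≡j) (Finₚ.toℕ<n j))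
  ≡-byIndexLabel {inj₂ d} {inj₂ e} _ d≡e = cong inj₂ (Finₚ.inject≤-injective p≤r p≤r d e d≡e)

  distinctIndex⇒adjacent : ∀ {u w} → index u ≢ index w → Adj u w
  distinctIndex⇒adjacent u≢w eq = u≢w (cong rank eq)

  bit : V → V → Bool
  bit u w = τ (index u) (index w) xor does (label u Fin.≟ label w)

  colour : V → V → Fin 2
  colour u w = Inverse.from Finₚ.2↔Bool (bit u w)

  colour-sym : ∀ u w → colour u w ≡ colour w u
  colour-sym u w = cong (Inverse.from Finₚ.2↔Bool)
    (cong₂ _xor_ (τ-sym (index u) (index w)) (does-sym Fin._≟_ (label u) (label w)))

  colour-injective : ∀ {u v w} → colour u w ≡ colour v w → bit u w ≡ bit v w
  colour-injective = Injection.injective (↔⇒↣ (↔-sym Finₚ.2↔Bool))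

  open RainbowMiddles Adj (λ u≢u → u≢u refl) colour

  rainbowMiddle : ∀ {u v w} → index w ≢ index u → index w ≢ index v → bit u w ≢ bit v w →
                  RainbowMiddle u v w
  rainbowMiddle {u} {v} {w} w≢u w≢v bits≢ =
    distinctIndex⇒adjacent (w≢u ∘ sym) , distinctIndex⇒adjacent w≢v ,
    λ eq → bits≢ (colour-injective {u} {v} {w} (trans eq (colour-sym w v)))

  samePartMiddles : ∀ {u v} → index u ≡ index v → label u ≢ label v →
                    Family V (RainbowMiddle u v) (2 * ℓ′)
  samePartMiddles {u} {v} parts≡ labels≢ =
    image (inj₁ ∘ swap) (λ eq → cong swap (inj₁-injective eq)) middle
      (product (pair labels≢) (without (index u) (everything ℓ)))
    where
      middle : ∀ {di : Fin r × Fin ℓ} →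
               (proj₁ di ≡ label u ⊎ proj₁ di ≡ label v) × (⊤ × toℕ (proj₂ di) ≢ index u) →
               RainbowMiddle u v (inj₁ (swap di))
      middle (d∈ , (_ , i≢u)) =
        rainbowMiddle i≢u (λ eq → i≢u (trans eq (sym parts≡)))
          (xor-≢ʳ (cong (λ a → τ a _) parts≡) (does-≢-oneOf Fin._≟_ labels≢ d∈))

  distinctPartMiddles : ∀ {u v} → index u ≢ index v → Family V (RainbowMiddle u v) (m * r)
  distinctPartMiddles {u} {v} parts≢ with label u Fin.≟ label v
  ... | yes labels≡ = image inj₁ inj₁-injective separated
                        (product (separating parts≢ (index≤ℓ u) (index≤ℓ v)) (everything r))
    where
      separated : ∀ {id : Fin ℓ × Fin r} → Separates τ (index u) (index v) (toℕ (proj₁ id)) × ⊤ →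
                  RainbowMiddle u v (inj₁ id)
      separated ((i≢u , i≢v , τ≢) , _) =
        rainbowMiddle i≢u i≢v (xor-≢ˡ τ≢ (cong (λ d → does (d Fin.≟ _)) labels≡))
  ... | no labels≢ = subst (Family V (RainbowMiddle u v)) (sym (*-distribˡ-+ m 2 r″))
      (image inj₁ inj₁-injective [ agreed , separated ]′
        (union disjoint
          (product (agreeing (index u) (index v)) (pair labels≢))
          (product (separating parts≢ (index≤ℓ u) (index≤ℓ v)) otherLabels)))
    where
      Agreed Separated : Fin ℓ × Fin r → Set
      Agreed    (i , d) = Agrees τ (index u) (index v) (toℕ i) × (d ≡ label u ⊎ d ≡ label v)
      Separated (i , d) = Separates τ (index u) (index v) (toℕ i) ×
                          toℕ d ≢ toℕ (label u) × toℕ d ≢ toℕ (label v)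
      otherLabels : Family (Fin r) (λ d → toℕ d ≢ toℕ (label u) × toℕ d ≢ toℕ (label v)) r″
      otherLabels = avoiding r″ (toℕ (label u)) (toℕ (label v))
      disjoint : ∀ {id} → Agreed id → Separated id → ⊥
      disjoint (_ , inj₁ refl) (_ , ≢u , _) = ≢u refl
      disjoint (_ , inj₂ refl) (_ , _ , ≢v) = ≢v refl
      agreed : ∀ {id} → Agreed id → RainbowMiddle u v (inj₁ id)
      agreed ((i≢u , i≢v , τ≡) , d∈) =
        rainbowMiddle i≢u i≢v (xor-≢ʳ τ≡ (does-≢-oneOf Fin._≟_ labels≢ d∈))
      separated : ∀ {id} → Separated id → RainbowMiddle u v (inj₁ id)
      separated ((i≢u , i≢v , τ≢) , d≢u , d≢v) =
        rainbowMiddle i≢u i≢v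
          (xor-≢ˡ τ≢ (does-≡-neither Fin._≟_ (d≢u ∘ cong toℕ) (d≢v ∘ cong toℕ)))

  rainbowConnected : k ≤ 2 * ℓ′ → k ≤ suc (m * r) → RainbowKConnectedWith Adj k 2
  rainbowConnected {k} k≤2ℓ′ k≤1+mr = (colour , colour-sym) , paths
    where
      paths : ∀ u v → u ≢ v → KRainbowPaths Adj colour k u v
      paths u v u≢v with index u ≟ index v
      ... | no parts≢ = KRainbowPaths-≤ k≤1+mr
              (edgeAndMiddlePaths (distinctIndex⇒adjacent parts≢) (distinctPartMiddles parts≢))
      ... | yes parts≡ = KRainbowPaths-≤ k≤2ℓ′
              (middlePaths u≢v (samePartMiddles parts≡ (u≢v ∘ ≡-byIndexLabel parts≡)))

module Grid (m′ : ℕ) {ℓ : ℕ} (L²≤ℓ : (3 + m′) * (3 + m′) ≤ ℓ) where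

  L : ℕ
  L = 3 + m′

  row col : ℕ → ℕ
  row a = a % L
  col a = a / L

  τ : ℕ → ℕ → Bool
  τ a b = does (row a ≟ row b) xor does (col a ≟ col b)

  τ-sym : ∀ a b → τ a b ≡ τ b a
  τ-sym a b = cong₂ _xor_ (does-sym _≟_ (row a) (row b)) (does-sym _≟_ (col a) (col b))

  τ-sameRow : ∀ a w → row a ≡ row w → col a ≢ col w → τ a w ≡ true
  τ-sameRow a w rows≡ cols≢ =
    cong₂ _xor_ (dec-true (row a ≟ row w) rows≡) (dec-false (col a ≟ col w) cols≢)

  τ-sameCol : ∀ a w → row a ≢ row w → col a ≡ col w → τ a w ≡ true
  τ-sameCol a w rows≢ cols≡ =
    cong₂ _xor_ (dec-false (row a ≟ row w) rows≢) (dec-true (col a ≟ col w) cols≡)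

  τ-apart : ∀ a w → row a ≢ row w → col a ≢ col w → τ a w ≡ false
  τ-apart a w rows≢ cols≢ =
    cong₂ _xor_ (dec-false (row a ≟ row w) rows≢) (dec-false (col a ≟ col w) cols≢)

  ≡-byRowCol : ∀ {a b} → row a ≡ row b → col a ≡ col b → a ≡ b
  ≡-byRowCol {a} {b} rows≡ cols≡ = begin
    a                  ≡⟨ m≡m%n+[m/n]*n a L ⟩
    row a + col a * L  ≡⟨ cong₂ (λ x y → x + y * L) rows≡ cols≡ ⟩
    row b + col b * L  ≡⟨ m≡m%n+[m/n]*n b L ⟨
    b                  ∎
    where open ≡-Reasoning

  cell : ∀ x y → x < L → suc y * L ≤ ℓ → Fin ℓ
  cell x y x<L bound = fromℕ< (≤-trans (+-monoˡ-< (y * L) x<L) bound)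

  toℕ-cell : ∀ x y x<L bound → toℕ (cell x y x<L bound) ≡ x + y * L
  toℕ-cell x y x<L bound = Finₚ.toℕ-fromℕ< {m = x + y * L} {n = ℓ} _

  row-cell : ∀ x y x<L bound → row (toℕ (cell x y x<L bound)) ≡ x
  row-cell x y x<L bound = begin
    row (toℕ (cell x y x<L bound))  ≡⟨ cong row (toℕ-cell x y x<L bound) ⟩
    (x + y * L) % L                 ≡⟨ [m+kn]%n≡m%n x y L ⟩
    x % L                           ≡⟨ m<n⇒m%n≡m x<L ⟩
    x                               ∎
    where open ≡-Reasoning

  col-cell : ∀ x y x<L bound → col (toℕ (cell x y x<L bound)) ≡ y
  col-cell x y x<L bound = begin
    col (toℕ (cell x y x<L bound))  ≡⟨ cong col (toℕ-cell x y x<L bound) ⟩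
    (x + y * L) / L                 ≡⟨ +-distrib-/-∣ʳ x (divides-refl y) ⟩
    x / L + y * L / L               ≡⟨ cong₂ _+_ (m<n⇒m/n≡0 x<L) (m*n/n≡m y L) ⟩
    y                               ∎
    where open ≡-Reasoning

  inGrid : ∀ y → y < L → suc y * L ≤ ℓ
  inGrid y y<L = ≤-trans (*-monoˡ-≤ L y<L) L²≤ℓ

  alongRow : ∀ x → x < L → ∀ α β →
    Family (Fin ℓ) (λ i → row (toℕ i) ≡ x × col (toℕ i) ≢ α × col (toℕ i) ≢ β) (suc m′)
  alongRow x x<L α β = image at at-injective at-valid (avoiding (suc m′) α β)
    where
      at : Fin L → Fin ℓ
      at y = cell x (toℕ y) x<L (inGrid (toℕ y) (Finₚ.toℕ<n y))
      row-at : ∀ y → row (toℕ (at y)) ≡ x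
      row-at y = row-cell x (toℕ y) x<L (inGrid (toℕ y) (Finₚ.toℕ<n y))
      col-at : ∀ y → col (toℕ (at y)) ≡ toℕ y
      col-at y = col-cell x (toℕ y) x<L (inGrid (toℕ y) (Finₚ.toℕ<n y))
      at-injective : Injective _≡_ _≡_ at
      at-injective {y} {y′} eq =
        Finₚ.toℕ-injective (trans (sym (col-at y)) (trans (cong (col ∘ toℕ) eq) (col-at y′)))
      at-valid : ∀ {y} → toℕ y ≢ α × toℕ y ≢ β →
                 row (toℕ (at y)) ≡ x × col (toℕ (at y)) ≢ α × col (toℕ (at y)) ≢ β
      at-valid {y} (y≢α , y≢β) =
        row-at y , y≢α ∘ trans (sym (col-at y)) , y≢β ∘ trans (sym (col-at y))

  alongColumn : ∀ y → suc y * L ≤ ℓ → ∀ α β →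
    Family (Fin ℓ) (λ i → col (toℕ i) ≡ y × row (toℕ i) ≢ α × row (toℕ i) ≢ β) (suc m′)
  alongColumn y bound α β = image at at-injective at-valid (avoiding (suc m′) α β)
    where
      at : Fin L → Fin ℓ
      at x = cell (toℕ x) y (Finₚ.toℕ<n x) bound
      row-at : ∀ x → row (toℕ (at x)) ≡ toℕ x
      row-at x = row-cell (toℕ x) y (Finₚ.toℕ<n x) bound
      col-at : ∀ x → col (toℕ (at x)) ≡ y
      col-at x = col-cell (toℕ x) y (Finₚ.toℕ<n x) bound
      at-injective : Injective _≡_ _≡_ at
      at-injective {x} {x′} eq =
        Finₚ.toℕ-injective (trans (sym (row-at x)) (trans (cong (row ∘ toℕ) eq) (row-at x′)))
      at-valid : ∀ {x} → toℕ x ≢ α × toℕ x ≢ β →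
                 col (toℕ (at x)) ≡ y × row (toℕ (at x)) ≢ α × row (toℕ (at x)) ≢ β
      at-valid {x} (x≢α , x≢β) =
        col-at x , x≢α ∘ trans (sym (row-at x)) , x≢β ∘ trans (sym (row-at x))

  -- Columns past the L-th may be incomplete, so the witnesses lie in the smaller column.
  separating-sameRow : ∀ {a b} → row a ≡ row b → col a < col b → b ≤ ℓ →
                       Family (Fin ℓ) (λ i → Separates τ a b (toℕ i)) (suc m′)
  separating-sameRow {a} {b} rows≡ cols< b≤ℓ =
    weaken separates (alongColumn (col a) bound (row a) (row a))
    where
      bound : suc (col a) * L ≤ ℓ
      bound = ≤-trans (*-monoˡ-≤ L cols<) (≤-trans (m/n*n≤m b L) b≤ℓ)
      separates : ∀ {i} → col (toℕ i) ≡ col a × row (toℕ i) ≢ row a × row (toℕ i) ≢ row a →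
                  Separates τ a b (toℕ i)
      separates {i} (colᵢ≡ , rowᵢ≢ , _) =
        rowᵢ≢ ∘ cong row ,
        (λ eq → rowᵢ≢ (trans (cong row eq) (sym rows≡))) ,
        ≡true-≡false⇒≢ (τ-sameCol a (toℕ i) (rowᵢ≢ ∘ sym) (sym colᵢ≡))
                       (τ-apart b (toℕ i) (λ eq → rowᵢ≢ (trans (sym eq) (sym rows≡)))
                                (λ eq → <-irrefl (trans (sym colᵢ≡) (sym eq)) cols<))

  separating : ∀ {a b} → a ≢ b → a ≤ ℓ → b ≤ ℓ →
               Family (Fin ℓ) (λ i → Separates τ a b (toℕ i)) (suc m′)
  separating {a} {b} a≢b a≤ℓ b≤ℓ with row a ≟ row b
  ... | no rows≢ = weaken separates (alongRow (row a) (m%n<n a L) (col a) (col b))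
    where
      separates : ∀ {i} → row (toℕ i) ≡ row a × col (toℕ i) ≢ col a × col (toℕ i) ≢ col b →
                  Separates τ a b (toℕ i)
      separates {i} (rowᵢ≡ , colᵢ≢a , colᵢ≢b) =
        colᵢ≢a ∘ cong col ,
        (λ eq → rows≢ (trans (sym rowᵢ≡) (cong row eq))) ,
        ≡true-≡false⇒≢ (τ-sameRow a (toℕ i) (sym rowᵢ≡) (colᵢ≢a ∘ sym))
                       (τ-apart b (toℕ i) (λ eq → rows≢ (trans (sym rowᵢ≡) (sym eq)))
                                          (colᵢ≢b ∘ sym))
  ... | yes rows≡ with <-cmp (col a) (col b)
  ...   | tri< cols< _ _ = separating-sameRow rows≡ cols< b≤ℓ
  ...   | tri≈ _ cols≡ _ = ⊥-elim (a≢b (≡-byRowCol rows≡ cols≡))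
  ...   | tri> _ _ cols> = weaken (Separates-sym {τ}) (separating-sameRow (sym rows≡) cols> a≤ℓ)

  agreeing : ∀ a b → Family (Fin ℓ) (λ i → Agrees τ a b (toℕ i)) (suc m′)
  agreeing a b = weaken agrees (alongColumn y₀ (inGrid y₀ (Finₚ.toℕ<n spare)) (row a) (row b))
    where
      spareColumns : Family (Fin L) (λ y → toℕ y ≢ col a × toℕ y ≢ col b) (suc m′)
      spareColumns = avoiding (suc m′) (col a) (col b)
      spare : Fin L
      spare = member spareColumns zero
      y₀ : ℕ
      y₀ = toℕ spare
      y₀≢a : y₀ ≢ col a
      y₀≢a = proj₁ (valid spareColumns zero)
      y₀≢b : y₀ ≢ col b
      y₀≢b = proj₂ (valid spareColumns zero)
      agrees : ∀ {i} → col (toℕ i) ≡ y₀ × row (toℕ i) ≢ row a × row (toℕ i) ≢ row b →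
               Agrees τ a b (toℕ i)
      agrees {i} (colᵢ≡ , rowᵢ≢a , rowᵢ≢b) =
        rowᵢ≢a ∘ cong row ,
        rowᵢ≢b ∘ cong row ,
        trans (τ-apart a (toℕ i) (rowᵢ≢a ∘ sym) (λ eq → y₀≢a (trans (sym colᵢ≡) (sym eq))))
              (sym (τ-apart b (toℕ i) (rowᵢ≢b ∘ sym) (λ eq → y₀≢b (trans (sym colᵢ≡) (sym eq)))))

twoColoursSuffice : ∀ {ℓ r p k ℓ₀} → 3 ≤ ℓ₀ → ℓ₀ * ℓ₀ ≤ ℓ → 2 ≤ r → p ≤ r →
                    k ≤ 2 * (ℓ ∸ 1) → k ≤ suc ((ℓ₀ ∸ 2) * r) →
                    RainbowKConnectedWith (MPAdj ℓ r p) k 2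
twoColoursSuffice {ℓ₀ = suc (suc (suc m′))} (s≤s (s≤s (s≤s _))) L²≤ℓ@(s≤s _) (s≤s (s≤s _)) p≤r =
  TwoColouring.rainbowConnected p≤r τ τ-sym separating agreeing
  where open Grid m′ L²≤ℓ

atLeastTwoColours : ∀ {ℓ r p k} → 1 ≤ ℓ → 2 ≤ r → 1 ≤ k →
                    ∀ j → j < 2 → ¬ RainbowKConnectedWith (MPAdj ℓ r p) k j
atLeastTwoColours (s≤s _) (s≤s (s≤s _)) (s≤s _) 0 _ = noColouring₀ (inj₁ (zero , zero))
atLeastTwoColours (s≤s _) (s≤s (s≤s _)) (s≤s _) 1 _ =
  noColouring₁ {u = inj₁ (zero , zero)} {v = inj₁ (zero , suc zero)}
    (λ ()) (λ adjacent → adjacent refl)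
atLeastTwoColours _ _ _ (suc (suc _)) (s≤s (s≤s ()))

theorem4 : (r p ℓ k ℓ₀ : ℕ) → 1 ≤ r → 1 ≤ p → p < r → 2 ≤ k →
    IsEll0 k r ℓ₀ → ℓ₀ * ℓ₀ ≤ ℓ →
    RcEquals (MPAdj ℓ r p) k 2
theorem4 r p ℓ k ℓ₀ _ 1≤p p<r 2≤k ((k+2≤2ℓ₀² , [k∸1]+2r≤rℓ₀) , _) ℓ₀²≤ℓ =
  twoColoursSuffice 3≤ℓ₀ ℓ₀²≤ℓ 2≤r (<⇒≤ p<r)
    (m+2≤2n⇒m≤2[n∸1] k ℓ (≤-trans k+2≤2ℓ₀² (*-monoʳ-≤ 2 ℓ₀²≤ℓ)))
    ([k∸1]+2r≤rl⇒k≤1+[l∸2]r k r ℓ₀ [k∸1]+2r≤rℓ₀) ,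
  atLeastTwoColours 1≤ℓ 2≤r (≤-trans (s≤s z≤n) 2≤k)
  where
    3≤ℓ₀ : 3 ≤ ℓ₀
    3≤ℓ₀ = [k∸1]+2r≤rl⇒2<l k r ℓ₀ 2≤k [k∸1]+2r≤rℓ₀
    2≤r : 2 ≤ r
    2≤r = ≤-trans (s≤s 1≤p) p<r
    1≤ℓ : 1 ≤ ℓ
    1≤ℓ = ≤-trans (*-mono-≤ {1} {ℓ₀} {1} {ℓ₀} 1≤ℓ₀ 1≤ℓ₀) ℓ₀²≤ℓ
      where 1≤ℓ₀ = ≤-trans (s≤s z≤n) 3≤ℓ₀
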